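{- Let $n\ge 0$. Then, with the notation of the context, \[ \mathcal A_n(t,q)=\sum_{I\text{ segmented composition of }n} t^{\operatorname{des}(I)}(1-t)^{\,n-\ell(I)}(q-t)^{\operatorname{seg}(I)}\,S^I . \]
   Context: A segmented composition of a positive integer $n$ is a finite sequence $I=(i_1,\dots,i_r)$ of positive integers summing to $n$, where each pair of consecutive entries is separated either by a comma or by a bar (for $n=0$ the only segmented composition is the empty one, with $\ell=\operatorname{seg}=\operatorname{des}=0$). Its length is $\ell(I)=r$; $\operatorname{seg}(I)$ is the number of bars and $\operatorname{des}(I)=\ell(I)-\operatorname{seg}(I)$. $\operatorname{Des}(I)$ is the set of partial sums $i_1+\cdots+i_k$, $k<r$, with $i_k$ followed by a comma, and $\operatorname{Bar}(I)$ the set of such partial sums with $i_k$ followed by a bar; for fixed $n$, $I$ is determined by the pair $(\operatorname{Des}(I),\operatorname{Bar}(I))$. For segmented compositions $I,K$ of the same $n$, write $I\succeq K$ iff $\operatorname{Des}(I)\supseteq\operatorname{Des}(K)$ and $\operatorname{Bar}(I)\subseteq\operatorname{Bar}(K)\subseteq \operatorname{Des}(I)\cup\operatorname{Bar}(I)$. Let $t,q$ be commuting indeterminates and let $V$ be a vector space over $\mathbb{Q}(t,q)$ with basis $(R_I)$ indexed by segmented compositions (the ribbon basis of the algebra of segmented composition quasi-symmetric functions). Define $S^I=\sum_{K:\,I\succeq K}R_K$ and $\mathcal A_n(t,q)=\sum_{I\text{ segmented composition of }n}t^{\operatorname{des}(I)}q^{\operatorname{seg}(I)}R_I$. -}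

module Defs where

open import Level using (Level)
open import Data.Nat using (ℕ; zero; suc; pred; _∸_)
open import Data.Fin using (Fin)
open import Data.Fin.Properties using (all?)
open import Data.Vec using (Vec; []; _∷_; lookup)
open import Data.Vec.Properties using (≡-dec)
open import Data.Bool using (Bool; true; false; if_then_else_)
open import Data.Product using (_×_)
open import Data.Sum using (_⊎_)
open import Relation.Nullary using (Dec; yes; no; does)
open import Relation.Nullary.Decidable using (_×-dec_; _⊎-dec_; _→-dec_)
open import Relation.Binary.PropositionalEquality using (_≡_; refl)
open import Relation.Binary.Definitions using (DecidableEquality)
open import Algebra.Bundles using (CommutativeRing)

-- What separates the partial sum at a given position (1 .. n-1):
--   none  : the position is not a partial sum of I
--   comma : the position belongs to Des(I)
--   bar   : the position belongs to Bar(I)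
data Sep : Set where
  none comma bar : Sep

_≟S_ : DecidableEquality Sep
none  ≟S none  = yes refl
none  ≟S comma = no λ ()
none  ≟S bar   = no λ ()
comma ≟S none  = no λ ()
comma ≟S comma = yes refl
comma ≟S bar   = no λ ()
bar   ≟S none  = no λ ()
bar   ≟S comma = no λ ()
bar   ≟S bar   = yes refl

-- A segmented composition of n, encoded by the pair (Des(I), Bar(I)) of
-- disjoint subsets of {1,…,n-1}: entry p (p : Fin (n ∸ 1)) describes the
-- integer p+1.  For n = 0 there is exactly one (empty) composition.
record SegComp (n : ℕ) : Set where
  constructor segComp
  field seps : Vec Sep (pred n)
open SegComp public

Des : ∀ {n} → SegComp n → Fin (pred n) → Set
Des I p = lookup (seps I) p ≡ comma

Bar : ∀ {n} → SegComp n → Fin (pred n) → Set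
Bar I p = lookup (seps I) p ≡ bar

cuts : ∀ {m} → Vec Sep m → ℕ
cuts [] = 0
cuts (none ∷ v) = cuts v
cuts (comma ∷ v) = suc (cuts v)
cuts (bar ∷ v) = suc (cuts v)

bars : ∀ {m} → Vec Sep m → ℕ
bars [] = 0
bars (bar ∷ v) = suc (bars v)
bars (_ ∷ v) = bars v

len : (n : ℕ) → SegComp n → ℕ
len zero    I = 0
len (suc n) I = suc (cuts (seps I))

seg : (n : ℕ) → SegComp n → ℕ
seg n I = bars (seps I)

des : (n : ℕ) → SegComp n → ℕ
des n I = len n I ∸ seg n I

_⪰_ : ∀ {n} → SegComp n → SegComp n → Set
I ⪰ K = ∀ p → (Des K p → Des I p) × (Bar I p → Bar K p) × (Bar K p → Des I p ⊎ Bar I p)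

_⪰?_ : ∀ {n} (I K : SegComp n) → Dec (I ⪰ K)
I ⪰? K = all? λ p →
  ((lookup (seps K) p ≟S comma) →-dec (lookup (seps I) p ≟S comma)) ×-dec
  (((lookup (seps I) p ≟S bar) →-dec (lookup (seps K) p ≟S bar)) ×-dec
   ((lookup (seps K) p ≟S bar) →-dec ((lookup (seps I) p ≟S comma) ⊎-dec (lookup (seps I) p ≟S bar))))

_≟C_ : ∀ {n} → DecidableEquality (SegComp n)
segComp u ≟C segComp v with ≡-dec _≟S_ u v
... | yes refl = yes refl
... | no u≢v = no λ { refl → u≢v refl }

module _ {a} {A : Set a} (_+_ : A → A → A) (0a : A) where
  sumAll : (m : ℕ) → (Vec Sep m → A) → A
  sumAll zero    f = f []
  sumAll (suc m) f =
    sumAll m (λ v → f (none ∷ v)) + (sumAll m (λ v → f (comma ∷ v)) + sumAll m (λ v → f (bar ∷ v)))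

-- The free module V (restricted to degree n) over a commutative ring R, with
-- basis R_I indexed by segmented compositions of n: vectors are coefficient
-- functions.  (The paper's Q(t,q) is the instance R = Q(t,q); the statement
-- below is over an arbitrary commutative ring and arbitrary t q.)
module Ribbon {c ℓ} (R : CommutativeRing c ℓ) where
  open CommutativeRing R

  pow : Carrier → ℕ → Carrier
  pow x zero    = 1#
  pow x (suc k) = x * pow x k

  V : ℕ → Set c
  V n = SegComp n → Carrier

  _≋_ : ∀ {n} → V n → V n → Set ℓ
  u ≋ v = ∀ K → u K ≈ v K

  0V : ∀ {n} → V n
  0V K = 0#

  _⊕_ : ∀ {n} → V n → V n → V n
  (u ⊕ v) K = u K + v K

  _·_ : ∀ {n} → Carrier → V n → V n
  (a · v) K = a * v K

  Σ-SC : (n : ℕ) → (SegComp n → V n) → V n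
  Σ-SC n f = sumAll _⊕_ 0V (pred n) (λ v → f (segComp v))

  Rb : ∀ {n} → SegComp n → V n
  Rb I K = if does (I ≟C K) then 1# else 0#

  S : (n : ℕ) → SegComp n → V n
  S n I = Σ-SC n (λ K → if does (I ⪰? K) then Rb K else 0V)

  𝒜 : Carrier → Carrier → (n : ℕ) → V n
  𝒜 t q n = Σ-SC n (λ I → (pow t (des n I) * pow q (seg n I)) · Rb I)

  rhs : Carrier → Carrier → (n : ℕ) → V n
  rhs t q n = Σ-SC n (λ I →
    ((pow t (des n I) * pow (1# - t) (n ∸ len n I)) * pow (q - t) (seg n I)) · S n I)

module Submission where

-- Compare the coefficients of a fixed ribbon function R_K on both
-- sides.  On the left it is the monomial t^des(K) q^seg(K); on the right it is
-- Σ_{I ⪰ K} t^des(I) (1-t)^(n-ℓ(I)) (q-t)^seg(I).  A segmented composition of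
-- n ≥ 1 is a word of separators (none, comma, bar) in the n-1 gaps, and the
-- order I ⪰ K is a condition imposed gap by gap.  The coefficient of I is
-- t times the product over the gaps of a weight (1-t, t or q-t according to
-- the separator), so by distributivity the sum over I ⪰ K factors as a product
-- over the gaps of K of local sums:
--   gap empty in K : (1-t) + t = 1,   comma in K : t,   bar in K : t + (q-t) = q,
-- which is exactly t^des(K) q^seg(K) (the leading t accounts for des = #commas+1).

open import Defs
open import Data.Nat as ℕ using (ℕ; zero; suc; pred; _∸_)
open import Data.Nat.Properties using (+-suc; m+n∸n≡m)
open import Data.Bool using (Bool; true; false; _∧_; if_then_else_)
open import Data.Product using (_×_)
open import Data.Sum using (_⊎_)
open import Data.Vec using (Vec; []; _∷_)
open import Data.Vec.Properties using (∷-injectiveʳ)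
open import Data.Vec.Relation.Binary.Pointwise.Inductive using (Pointwise)
  renaming (decidable to pointwise?)
import Data.Vec.Relation.Binary.Pointwise.Extensional as Extensional
open import Function.Bundles using (_⇔_; mk⇔)
open import Relation.Nullary using (does; ¬_)
open import Relation.Nullary.Decidable using (_×-dec_; _⊎-dec_; _→-dec_; does-⇔; dec-true; dec-false)
open import Relation.Binary.Definitions using (Decidable)
open import Relation.Binary.PropositionalEquality using (_≡_; refl; cong; sym; trans)
open import Algebra.Bundles using (CommutativeRing)

Dominates : Sep → Sep → Set
Dominates i k = (k ≡ comma → i ≡ comma) × (i ≡ bar → k ≡ bar) × (k ≡ bar → i ≡ comma ⊎ i ≡ bar)

dominates? : Decidable Dominates
dominates? i k =
  (k ≟S comma →-dec i ≟S comma) ×-dec (i ≟S bar →-dec k ≟S bar) ×-dec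
  (k ≟S bar →-dec (i ≟S comma ⊎-dec i ≟S bar))

⪰⇔pointwise : ∀ {n} {I K : SegComp n} → I ⪰ K ⇔ Pointwise Dominates (seps I) (seps K)
⪰⇔pointwise = mk⇔ (λ I⪰K → Extensional.extensional⇒inductive (Extensional.ext I⪰K))
                  (λ I≽K → Extensional.Pointwise.app (Extensional.inductive⇒extensional I≽K))

-- Boolean form of the order on separator words.  Unlike the decision
-- procedure _⪰?_ it unfolds gap by gap: (a ∷ u) ≽ (s ∷ k) reduces to
-- does (dominates? a s) ∧ u ≽ k.
_≽_ : ∀ {m} → Vec Sep m → Vec Sep m → Bool
u ≽ k = does (pointwise? dominates? u k)

⪰?-pointwise : ∀ {n} (I K : SegComp n) → does (I ⪰? K) ≡ seps I ≽ seps K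
⪰?-pointwise I K = does-⇔ (⪰⇔pointwise {I = I} {K}) (I ⪰? K) (pointwise? dominates? (seps I) (seps K))

-- Numbers of commas and of empty gaps in a separator word; for n ≥ 1 they give
-- des(I) = #commas + 1 and n - ℓ(I) = #empty gaps.
commas nones : ∀ {m} → Vec Sep m → ℕ
commas []          = 0
commas (comma ∷ v) = suc (commas v)
commas (_ ∷ v)     = commas v
nones []         = 0
nones (none ∷ v) = suc (nones v)
nones (_ ∷ v)    = nones v

cuts≡commas+bars : ∀ {m} (v : Vec Sep m) → cuts v ≡ commas v ℕ.+ bars v
cuts≡commas+bars []          = refl
cuts≡commas+bars (none ∷ v)  = cuts≡commas+bars v
cuts≡commas+bars (comma ∷ v) = cong suc (cuts≡commas+bars v)
cuts≡commas+bars (bar ∷ v)   = trans (cong suc (cuts≡commas+bars v)) (sym (+-suc (commas v) (bars v)))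

gaps≡nones+cuts : ∀ {m} (v : Vec Sep m) → m ≡ nones v ℕ.+ cuts v
gaps≡nones+cuts []          = refl
gaps≡nones+cuts (none ∷ v)  = cong suc (gaps≡nones+cuts v)
gaps≡nones+cuts (comma ∷ v) = trans (cong suc (gaps≡nones+cuts v)) (sym (+-suc (nones v) (cuts v)))
gaps≡nones+cuts (bar ∷ v)   = trans (cong suc (gaps≡nones+cuts v)) (sym (+-suc (nones v) (cuts v)))

des-segComp : ∀ {m} (v : Vec Sep m) → des (suc m) (segComp v) ≡ suc (commas v)
des-segComp v = trans (cong (λ c → suc c ∸ bars v) (cuts≡commas+bars v)) (m+n∸n≡m (suc (commas v)) (bars v))

n∸len-segComp : ∀ {m} (v : Vec Sep m) → suc m ∸ len (suc m) (segComp v) ≡ nones v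
n∸len-segComp {m} v = trans (cong (_∸ cuts v) (gaps≡nones+cuts v)) (m+n∸n≡m (nones v) (cuts v))

module Coefficients {c ℓ} (R : CommutativeRing c ℓ) where
  open CommutativeRing R renaming (refl to ≈-refl; sym to ≈-sym; trans to ≈-trans)
  open Ribbon R
  open import Algebra.Properties.CommutativeSemigroup *-commutativeSemigroup
    using (interchange; x∙yz≈y∙xz)
  open import Relation.Binary.Reasoning.Setoid setoid

  ΣV : (m : ℕ) → (Vec Sep m → Carrier) → Carrier
  ΣV = sumAll _+_ 0#

  Σ-at : ∀ {n} m (f : Vec Sep m → V n) (K : SegComp n) → sumAll _⊕_ 0V m f K ≡ ΣV m (λ v → f v K)
  Σ-at zero    f K = refl
  Σ-at (suc m) f K rewrite Σ-at m (λ v → f (none ∷ v)) K | Σ-at m (λ v → f (comma ∷ v)) K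
                         | Σ-at m (λ v → f (bar ∷ v)) K = refl

  Σ-cong : ∀ m {f g : Vec Sep m → Carrier} → (∀ v → f v ≈ g v) → ΣV m f ≈ ΣV m g
  Σ-cong zero    f≈g = f≈g []
  Σ-cong (suc m) f≈g =
    +-cong (Σ-cong m (λ v → f≈g _)) (+-cong (Σ-cong m (λ v → f≈g _)) (Σ-cong m (λ v → f≈g _)))

  Σ-zero : ∀ m {f : Vec Sep m → Carrier} → (∀ v → f v ≈ 0#) → ΣV m f ≈ 0#
  Σ-zero zero    f≈0 = f≈0 []
  Σ-zero (suc m) f≈0 = begin
    _              ≈⟨ +-cong (Σ-zero m (λ v → f≈0 _)) (+-cong (Σ-zero m (λ v → f≈0 _)) (Σ-zero m (λ v → f≈0 _))) ⟩
    0# + (0# + 0#) ≈⟨ +-identityˡ _ ⟩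
    0# + 0#        ≈⟨ +-identityˡ _ ⟩
    0#             ∎

  Σ-*ˡ : ∀ m (a : Carrier) (f : Vec Sep m → Carrier) → ΣV m (λ v → a * f v) ≈ a * ΣV m f
  Σ-*ˡ zero    a f = ≈-refl
  Σ-*ˡ (suc m) a f =
    ≈-trans (+-cong (Σ-*ˡ m a _) (+-cong (Σ-*ˡ m a _) (Σ-*ˡ m a _)))
            (≈-trans (+-cong ≈-refl (≈-sym (distribˡ a _ _))) (≈-sym (distribˡ a _ _)))

  -‿+-cancel : ∀ x y → (x - y) + y ≈ x
  -‿+-cancel x y = begin
    (x - y) + y   ≈⟨ +-assoc x (- y) y ⟩
    x + (- y + y) ≈⟨ +-cong ≈-refl (-‿inverseˡ y) ⟩
    x + 0#        ≈⟨ +-identityʳ x ⟩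
    x             ∎

  Σ-delta : ∀ m (k : Vec Sep m) (f : Vec Sep m → Carrier) → (∀ v → ¬ v ≡ k → f v ≈ 0#) → ΣV m f ≈ f k
  Σ-delta zero    []          f off = ≈-refl
  Σ-delta (suc m) (none ∷ k)  f off = begin
    _                       ≈⟨ +-cong (Σ-delta m k _ (λ v v≢k → off _ (λ eq → v≢k (∷-injectiveʳ eq))))
                                  (+-cong (Σ-zero m (λ v → off _ λ ())) (Σ-zero m (λ v → off _ λ ()))) ⟩
    f (none ∷ k) + (0# + 0#) ≈⟨ +-cong ≈-refl (+-identityˡ 0#) ⟩
    f (none ∷ k) + 0#        ≈⟨ +-identityʳ _ ⟩
    f (none ∷ k)             ∎
  Σ-delta (suc m) (comma ∷ k) f off = begin
    _                       ≈⟨ +-cong (Σ-zero m (λ v → off _ λ ()))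
                                  (+-cong (Σ-delta m k _ (λ v v≢k → off _ (λ eq → v≢k (∷-injectiveʳ eq))))
                                          (Σ-zero m (λ v → off _ λ ()))) ⟩
    0# + (f (comma ∷ k) + 0#) ≈⟨ +-identityˡ _ ⟩
    f (comma ∷ k) + 0#        ≈⟨ +-identityʳ _ ⟩
    f (comma ∷ k)             ∎
  Σ-delta (suc m) (bar ∷ k)   f off = begin
    _                       ≈⟨ +-cong (Σ-zero m (λ v → off _ λ ()))
                                  (+-cong (Σ-zero m (λ v → off _ λ ()))
                                          (Σ-delta m k _ (λ v v≢k → off _ (λ eq → v≢k (∷-injectiveʳ eq))))) ⟩
    0# + (0# + f (bar ∷ k)) ≈⟨ +-identityˡ _ ⟩
    0# + f (bar ∷ k)        ≈⟨ +-identityˡ _ ⟩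
    f (bar ∷ k)             ∎

  Π : ∀ {m} → (Sep → Carrier) → Vec Sep m → Carrier
  Π w []      = 1#
  Π w (a ∷ v) = w a * Π w v

  Π₂ : ∀ {m} → (Sep → Sep → Carrier) → Vec Sep m → Vec Sep m → Carrier
  Π₂ g []      []      = 1#
  Π₂ g (a ∷ u) (s ∷ k) = g a s * Π₂ g u k

  Π-monomial : ∀ {m} (w : Sep → Carrier) (v : Vec Sep m) →
    Π w v ≈ (pow (w comma) (commas v) * pow (w none) (nones v)) * pow (w bar) (bars v)
  Π-monomial w []      = ≈-sym (≈-trans (*-identityʳ _) (*-identityʳ _))
  Π-monomial w (a ∷ v) = ≈-trans (*-cong ≈-refl (Π-monomial w v)) (absorb a)
    where
    absorb : ∀ a → w a * ((pow (w comma) (commas v) * pow (w none) (nones v)) * pow (w bar) (bars v)) ≈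
             (pow (w comma) (commas (a ∷ v)) * pow (w none) (nones (a ∷ v))) * pow (w bar) (bars (a ∷ v))
    absorb none  = ≈-trans (≈-sym (*-assoc _ _ _)) (*-cong (x∙yz≈y∙xz _ _ _) ≈-refl)
    absorb comma = ≈-trans (≈-sym (*-assoc _ _ _)) (*-cong (≈-sym (*-assoc _ _ _)) ≈-refl)
    absorb bar   = x∙yz≈y∙xz _ _ _

  pow-1# : ∀ k → pow 1# k ≈ 1#
  pow-1# zero    = ≈-refl
  pow-1# (suc k) = ≈-trans (*-identityˡ _) (pow-1# k)

  Σ-Π₂ : ∀ m (g : Sep → Sep → Carrier) (h : Sep → Carrier) →
    (∀ s → g none s + (g comma s + g bar s) ≈ h s) →
    ∀ (k : Vec Sep m) → ΣV m (λ u → Π₂ g u k) ≈ Π h k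
  Σ-Π₂ zero    g h local []      = ≈-refl
  Σ-Π₂ (suc m) g h local (s ∷ k) = begin
    ΣV m (λ u → g none s * Π₂ g u k) + (ΣV m (λ u → g comma s * Π₂ g u k) + ΣV m (λ u → g bar s * Π₂ g u k))
      ≈⟨ +-cong (Σ-*ˡ m _ _) (+-cong (Σ-*ˡ m _ _) (Σ-*ˡ m _ _)) ⟩
    g none s * Σk + (g comma s * Σk + g bar s * Σk)
      ≈⟨ ≈-trans (+-cong ≈-refl (≈-sym (distribʳ Σk _ _))) (≈-sym (distribʳ Σk _ _)) ⟩
    (g none s + (g comma s + g bar s)) * Σk
      ≈⟨ *-cong (local s) (Σ-Π₂ m g h local k) ⟩
    h s * Π h k ∎
    where Σk = ΣV m (λ u → Π₂ g u k)

  ind : Bool → Carrier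
  ind b = if b then 1# else 0#

  ind-∧ : ∀ b d → ind (b ∧ d) ≈ ind b * ind d
  ind-∧ true  d = ≈-sym (*-identityˡ _)
  ind-∧ false d = ≈-sym (zeroˡ _)

  Π-restrict : ∀ {m} (w : Sep → Carrier) (u k : Vec Sep m) →
    Π w u * ind (u ≽ k) ≈ Π₂ (λ a s → w a * ind (does (dominates? a s))) u k
  Π-restrict w []      []      = *-identityʳ _
  Π-restrict w (a ∷ u) (s ∷ k) = begin
    (w a * Π w u) * ind (does (dominates? a s) ∧ u ≽ k)         ≈⟨ *-cong ≈-refl (ind-∧ _ _) ⟩
    (w a * Π w u) * (ind (does (dominates? a s)) * ind (u ≽ k)) ≈⟨ interchange _ _ _ _ ⟩
    (w a * ind (does (dominates? a s))) * (Π w u * ind (u ≽ k)) ≈⟨ *-cong ≈-refl (Π-restrict w u k) ⟩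
    (w a * ind (does (dominates? a s))) * Π₂ (λ a s → w a * ind (does (dominates? a s))) u k ∎

  Rb-self : ∀ {n} (K : SegComp n) → Rb K K ≈ 1#
  Rb-self K rewrite dec-true (K ≟C K) refl = ≈-refl

  Rb-other : ∀ {n} (J K : SegComp n) → ¬ J ≡ K → Rb J K ≈ 0#
  Rb-other J K J≢K rewrite dec-false (J ≟C K) J≢K = ≈-refl

  Σ-SC-at : ∀ n (f : SegComp n → V n) (K : SegComp n) →
    (∀ J → ¬ J ≡ K → f J K ≈ 0#) → Σ-SC n f K ≈ f K K
  Σ-SC-at n f (segComp k) off = begin
    Σ-SC n f (segComp k)
      ≡⟨ Σ-at (pred n) (λ v → f (segComp v)) (segComp k) ⟩
    ΣV (pred n) (λ v → f (segComp v) (segComp k))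
      ≈⟨ Σ-delta (pred n) k _ (λ v v≢k → off (segComp v) (λ { refl → v≢k refl })) ⟩
    f (segComp k) (segComp k) ∎

  Σ-SC-diagonal : ∀ n (a : SegComp n → Carrier) (K : SegComp n) → Σ-SC n (λ I → a I · Rb I) K ≈ a K
  Σ-SC-diagonal n a K = begin
    Σ-SC n (λ I → a I · Rb I) K
      ≈⟨ Σ-SC-at n _ K (λ J J≢K → ≈-trans (*-cong ≈-refl (Rb-other J K J≢K)) (zeroʳ _)) ⟩
    a K * Rb K K
      ≈⟨ *-cong ≈-refl (Rb-self K) ⟩
    a K * 1#
      ≈⟨ *-identityʳ _ ⟩
    a K ∎

  S-at : ∀ n (I K : SegComp n) → S n I K ≈ ind (seps I ≽ seps K)
  S-at n I K = begin
    S n I K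
      ≈⟨ Σ-SC-at n _ K (λ J → restricted-off (does (I ⪰? J)) J) ⟩
    (if does (I ⪰? K) then Rb K else 0V) K
      ≡⟨ cong (λ b → (if b then Rb K else 0V) K) (⪰?-pointwise I K) ⟩
    (if seps I ≽ seps K then Rb K else 0V) K
      ≈⟨ restricted-self (seps I ≽ seps K) ⟩
    ind (seps I ≽ seps K) ∎
    where
    restricted-off : ∀ b J → ¬ J ≡ K → (if b then Rb J else 0V) K ≈ 0#
    restricted-off true  J J≢K = Rb-other J K J≢K
    restricted-off false J J≢K = ≈-refl
    restricted-self : ∀ b → (if b then Rb K else 0V) K ≈ ind b
    restricted-self true  = Rb-self K
    restricted-self false = ≈-refl

  module _ (t q : Carrier) where

    𝒜-coefficient rhs-coefficient : ∀ n → SegComp n → Carrier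
    𝒜-coefficient   n I = pow t (des n I) * pow q (seg n I)
    rhs-coefficient n I = (pow t (des n I) * pow (1# - t) (n ∸ len n I)) * pow (q - t) (seg n I)

    𝒜-at : ∀ n (K : SegComp n) → 𝒜 t q n K ≈ 𝒜-coefficient n K
    𝒜-at n = Σ-SC-diagonal n (𝒜-coefficient n)

    rhs-at : ∀ n (K : SegComp n) →
      rhs t q n K ≈ ΣV (pred n) (λ v → rhs-coefficient n (segComp v) * ind (v ≽ seps K))
    rhs-at n K = begin
      rhs t q n K
        ≡⟨ Σ-at (pred n) _ K ⟩
      ΣV (pred n) (λ v → rhs-coefficient n (segComp v) * S n (segComp v) K)
        ≈⟨ Σ-cong (pred n) (λ v → *-cong ≈-refl (S-at n (segComp v) K)) ⟩
      ΣV (pred n) (λ v → rhs-coefficient n (segComp v) * ind (v ≽ seps K)) ∎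

    lhs-weight rhs-weight : Sep → Carrier
    lhs-weight none  = 1#
    lhs-weight comma = t
    lhs-weight bar   = q
    rhs-weight none  = 1# - t
    rhs-weight comma = t
    rhs-weight bar   = q - t

    𝒜-coefficient-Π : ∀ {m} (k : Vec Sep m) → 𝒜-coefficient (suc m) (segComp k) ≈ t * Π lhs-weight k
    𝒜-coefficient-Π {m} k = begin
      pow t (des (suc m) (segComp k)) * pow q (bars k)
        ≡⟨ cong (λ d → pow t d * pow q (bars k)) (des-segComp k) ⟩
      t * pow t (commas k) * pow q (bars k)
        ≈⟨ *-assoc _ _ _ ⟩
      t * (pow t (commas k) * pow q (bars k))
        ≈⟨ *-cong ≈-refl (*-cong (≈-sym (*-identityʳ _)) ≈-refl) ⟩
      t * ((pow t (commas k) * 1#) * pow q (bars k))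
        ≈⟨ *-cong ≈-refl (*-cong (*-cong ≈-refl (≈-sym (pow-1# (nones k)))) ≈-refl) ⟩
      t * ((pow t (commas k) * pow 1# (nones k)) * pow q (bars k))
        ≈⟨ *-cong ≈-refl (≈-sym (Π-monomial lhs-weight k)) ⟩
      t * Π lhs-weight k ∎

    rhs-coefficient-Π : ∀ {m} (v : Vec Sep m) → rhs-coefficient (suc m) (segComp v) ≈ t * Π rhs-weight v
    rhs-coefficient-Π {m} v = begin
      rhs-coefficient (suc m) (segComp v)
        ≡⟨ cong (λ d → (pow t d * pow (1# - t) (suc m ∸ len (suc m) (segComp v))) * pow (q - t) (bars v)) (des-segComp v) ⟩
      (t * pow t (commas v) * pow (1# - t) (suc m ∸ len (suc m) (segComp v))) * pow (q - t) (bars v)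
        ≡⟨ cong (λ g → (t * pow t (commas v) * pow (1# - t) g) * pow (q - t) (bars v)) (n∸len-segComp v) ⟩
      (t * pow t (commas v) * pow (1# - t) (nones v)) * pow (q - t) (bars v)
        ≈⟨ ≈-trans (*-cong (*-assoc _ _ _) ≈-refl) (*-assoc _ _ _) ⟩
      t * ((pow t (commas v) * pow (1# - t) (nones v)) * pow (q - t) (bars v))
        ≈⟨ *-cong ≈-refl (≈-sym (Π-monomial rhs-weight v)) ⟩
      t * Π rhs-weight v ∎

    gap-sum : ∀ s → let g a = rhs-weight a * ind (does (dominates? a s)) in
      g none + (g comma + g bar) ≈ lhs-weight s
    gap-sum none  = begin
      (1# - t) * 1# + (t * 1# + (q - t) * 0#) ≈⟨ +-cong (*-identityʳ _) (+-cong (*-identityʳ _) (zeroʳ _)) ⟩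
      (1# - t) + (t + 0#)                     ≈⟨ +-cong ≈-refl (+-identityʳ t) ⟩
      (1# - t) + t                            ≈⟨ -‿+-cancel 1# t ⟩
      1#                                      ∎
    gap-sum comma = begin
      (1# - t) * 0# + (t * 1# + (q - t) * 0#) ≈⟨ +-cong (zeroʳ _) (+-cong (*-identityʳ _) (zeroʳ _)) ⟩
      0# + (t + 0#)                           ≈⟨ +-identityˡ _ ⟩
      t + 0#                                  ≈⟨ +-identityʳ t ⟩
      t                                       ∎
    gap-sum bar   = begin
      (1# - t) * 0# + (t * 1# + (q - t) * 1#) ≈⟨ +-cong (zeroʳ _) (+-cong (*-identityʳ _) (*-identityʳ _)) ⟩
      0# + (t + (q - t))                      ≈⟨ +-identityˡ _ ⟩
      t + (q - t)                             ≈⟨ +-comm t (q - t) ⟩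
      (q - t) + t                             ≈⟨ -‿+-cancel q t ⟩
      q                                       ∎

    coefficients-agree : ∀ n (k : Vec Sep (pred n)) →
      𝒜-coefficient n (segComp k) ≈ ΣV (pred n) (λ v → rhs-coefficient n (segComp v) * ind (v ≽ k))
    coefficients-agree zero    [] = ≈-sym (≈-trans (*-identityʳ _) (*-identityʳ _))
    coefficients-agree (suc m) k  = begin
      𝒜-coefficient (suc m) (segComp k)
        ≈⟨ 𝒜-coefficient-Π k ⟩
      t * Π lhs-weight k
        ≈⟨ *-cong ≈-refl (≈-sym (Σ-Π₂ m _ lhs-weight gap-sum k)) ⟩
      t * ΣV m (λ v → Π₂ (λ a s → rhs-weight a * ind (does (dominates? a s))) v k)
        ≈⟨ *-cong ≈-refl (Σ-cong m (λ v → ≈-sym (Π-restrict rhs-weight v k))) ⟩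
      t * ΣV m (λ v → Π rhs-weight v * ind (v ≽ k))
        ≈⟨ ≈-sym (Σ-*ˡ m t _) ⟩
      ΣV m (λ v → t * (Π rhs-weight v * ind (v ≽ k)))
        ≈⟨ Σ-cong m (λ v → ≈-sym (*-assoc _ _ _)) ⟩
      ΣV m (λ v → (t * Π rhs-weight v) * ind (v ≽ k))
        ≈⟨ Σ-cong m (λ v → *-cong (≈-sym (rhs-coefficient-Π v)) ≈-refl) ⟩
      ΣV m (λ v → rhs-coefficient (suc m) (segComp v) * ind (v ≽ k)) ∎

mainTheorem9 : ∀ {c ℓ} (R : CommutativeRing c ℓ) (t q : CommutativeRing.Carrier R) (n : ℕ) →
    Ribbon._≋_ R (Ribbon.𝒜 R t q n) (Ribbon.rhs R t q n)
mainTheorem9 R t q n K = begin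
  𝒜 t q n K
    ≈⟨ 𝒜-at t q n K ⟩
  𝒜-coefficient t q n K
    ≈⟨ coefficients-agree t q n (seps K) ⟩
  ΣV (pred n) (λ v → rhs-coefficient t q n (segComp v) * ind (v ≽ seps K))
    ≈⟨ ≈-sym (rhs-at t q n K) ⟩
  rhs t q n K ∎
  where
  open CommutativeRing R using (setoid; _*_) renaming (sym to ≈-sym)
  open Ribbon R using (𝒜; rhs)
  open Coefficients R
  open import Relation.Binary.Reasoning.Setoid setoid
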